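{- Let $\Sigma$ be a $d$-regular bipartite graph with bipartition classes $X$ and $Y$, let $1\le\psi\le d-1$, let $a,g$ be integers, $v\in Y$, and $t=g-a$. If $A\in\mathcal{G}(a,g,v)$ and $(F,S)$ is a $\psi$-approximation for $A$, then $$|S| \le |F| + \frac{2t\psi}{d-\psi}.$$
   Context: In $\Sigma$, $\rho$ denotes graph distance; for $A\subseteq X$, $G=N(A)\subseteq Y$ is its neighbourhood and $[A]=\{x\in X: N(x)\subseteq N(A)\}$ its closure. For a vertex $u$ and set $B$, $d_B(u)=|N(u)\cap B|$. A set $A$ is 2-linked if any two of its elements are joined by a sequence of elements of $A$ with consecutive elements at distance at most 2. $\mathcal{G}(a,g,v)$ is the family of 2-linked $A\subseteq X$ with $|[A]|=a$, $|N(A)|=g$, $v\in N(A)$. A $\psi$-approximation for $A\subseteq X$ is a pair $(F,S)$ with $F\subseteq Y$, $S\subseteq X$ such that $F\subseteq G$, $S\supseteq[A]$, $d_F(u)\ge d-\psi$ for all $u\in S$, and $d_{X\setminus S}(w)\ge d-\psi$ for all $w\in Y\setminus F$. -}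

module Defs where

open import Data.Nat using (ℕ; zero; suc; _+_; _∸_; _≥_)
open import Data.Bool using (Bool; true; false; _∧_; _∨_; not; if_then_else_)
open import Data.Fin using (Fin; zero; suc)
open import Data.Fin.Subset using (Subset; _∈_; _∉_; _⊆_; ∁; ∣_∣)
open import Data.Vec using (lookup; tabulate)
open import Data.Product using (Σ; _×_; ∃)
open import Data.Sum using (_⊎_)
open import Relation.Binary.PropositionalEquality using (_≡_)
open import Relation.Binary.Construct.Closure.ReflexiveTransitive using (Star)

anyFin : ∀ {k} → (Fin k → Bool) → Bool
anyFin {zero}  f = false
anyFin {suc k} f = f zero ∨ anyFin (λ i → f (suc i))

allFin : ∀ {k} → (Fin k → Bool) → Bool
allFin {zero}  f = true
allFin {suc k} f = f zero ∧ allFin (λ i → f (suc i))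

countFin : ∀ {k} → (Fin k → Bool) → ℕ
countFin {zero}  f = zero
countFin {suc k} f = (if f zero then 1 else 0) + countFin (λ i → f (suc i))

-- A finite simple bipartite graph with classes X = Fin m and Y = Fin n;
-- adj x y = true iff x ∈ X and y ∈ Y are adjacent.
record BipGraph : Set where
  field
    m n : ℕ
    adj : Fin m → Fin n → Bool

module _ (Γ : BipGraph) where
  open BipGraph Γ

  Regular : ℕ → Set
  Regular d = (∀ x → countFin (λ y → adj x y) ≡ d)
            × (∀ y → countFin (λ x → adj x y) ≡ d)

  N : Subset m → Subset n
  N A = tabulate (λ y → anyFin (λ x → lookup A x ∧ adj x y))

  -- closure [A] = {x ∈ X : N(x) ⊆ N(A)}
  closure : Subset m → Subset m
  closure A = tabulate (λ x → allFin (λ y → not (adj x y) ∨ lookup (N A) y))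

  degX : Fin m → Subset n → ℕ
  degX u B = countFin (λ y → adj u y ∧ lookup B y)

  degY : Fin n → Subset m → ℕ
  degY w B = countFin (λ x → adj x w ∧ lookup B x)

  -- ρ(x, x') ≤ 2 for x, x' ∈ X (in a bipartite graph: equal or a common neighbour)
  Close : Fin m → Fin m → Set
  Close x x' = x ≡ x' ⊎ (∃ λ y → (adj x y ≡ true) × (adj x' y ≡ true))

  StepIn : Subset m → Fin m → Fin m → Set
  StepIn A x x' = (x ∈ A) × (x' ∈ A) × Close x x'

  TwoLinked : Subset m → Set
  TwoLinked A = ∀ x x' → x ∈ A → x' ∈ A → Star (StepIn A) x x'

  InG : ℕ → ℕ → Fin n → Subset m → Set
  InG a g v A = TwoLinked A × (∣ closure A ∣ ≡ a) × (∣ N A ∣ ≡ g) × (v ∈ N A)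

  IsApprox : ℕ → ℕ → Subset m → Subset n → Subset m → Set
  IsApprox d ψ A F S =
      (F ⊆ N A)
    × (closure A ⊆ S)
    × (∀ u → u ∈ S → degX u F ≥ d ∸ ψ)
    × (∀ w → w ∉ F → degY w (∁ S) ≥ d ∸ ψ)

{-# OPTIONS --safe #-}
-- Count the edges of Σ between X and G = N(A). Every vertex of [A] sends all d of its
-- edges into G; every vertex of S ∖ [A] sends at least d - ψ edges into F ⊆ G; every
-- vertex of G ∖ F receives at least d - ψ edges from X ∖ S. These three edge classes are
-- disjoint, so a·d + |S ∖ [A]|(d - ψ) + |G ∖ F|(d - ψ) ≤ g·d. With |S| = a + |S ∖ [A]|,
-- g = |F| + |G ∖ F| and d = (d - ψ) + ψ this rearranges to (d - ψ)|S| + ψa ≤ (d - ψ)|F| + ψg,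
-- and a ≤ g supplies the second ψ.
module Submission where

open import Defs
open import Data.Nat using (ℕ; _+_; _*_; _∸_; _≤_)
open import Data.Fin using (Fin)
open import Data.Fin.Subset using (Subset; ∣_∣)

open import Data.Nat.Properties
open import Algebra.Properties.Semiring.Sum +-*-semiring
  using (sum; sum-syntax; sum-cong-≗; ∑-distrib-+; ∑-comm; *-distribʳ-sum)
open import Data.Bool using (Bool; true; false; _∧_; _∨_; not; if_then_else_)
open import Data.Bool.Properties using (∧-conicalˡ; ∧-conicalʳ; ∧-zeroʳ)
open import Data.Fin using (zero; suc)
open import Data.Fin.Subset using (_∉_; ∁)
open import Data.Nat using (zero; suc; _<_; z≤n; >-nonZero)
open import Data.Nat.Tactic.RingSolver using (solve-∀)
open import Data.Product using (_,_; proj₁; proj₂)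
open import Data.Vec using ([]; _∷_; lookup)
open import Data.Vec.Properties using (lookup-map; lookup∘tabulate; []=⇒lookup; lookup⇒[]=)
open import Function using (_∘_; flip)
open import Relation.Binary.PropositionalEquality

𝟙 : Bool → ℕ
𝟙 b = if b then 1 else 0

𝟙-∧ : ∀ a b → 𝟙 (a ∧ b) ≡ 𝟙 a * 𝟙 b
𝟙-∧ true  b = sym (+-identityʳ (𝟙 b))
𝟙-∧ false b = refl

𝟙-split : ∀ s c → (c ≡ true → s ≡ true) → 𝟙 s ≡ 𝟙 c + 𝟙 (s ∧ not c)
𝟙-split s     true  c⇒s rewrite c⇒s refl = refl
𝟙-split true  false _   = refl
𝟙-split false false _   = refl

𝟙*-mono-≤ : ∀ b {δ c} → (b ≡ true → δ ≤ c) → 𝟙 b * δ ≤ 𝟙 b * c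
𝟙*-mono-≤ true  δ≤c = +-monoˡ-≤ 0 (δ≤c refl)
𝟙*-mono-≤ false _   = z≤n

allFin-true : ∀ {k} (f : Fin k → Bool) → allFin f ≡ true → ∀ i → f i ≡ true
allFin-true {suc k} f all i with f zero in f₀
allFin-true {suc k} f all zero    | true = f₀
allFin-true {suc k} f all (suc i) | true = allFin-true (f ∘ suc) all i

∑-mono-≤ : ∀ {k} {f g : Fin k → ℕ} → (∀ i → f i ≤ g i) → sum f ≤ sum g
∑-mono-≤ {zero}  _   = z≤n
∑-mono-≤ {suc k} f≤g = +-mono-≤ (f≤g zero) (∑-mono-≤ (f≤g ∘ suc))

∑-+₃-mono-≤ : ∀ {k} {f g h u : Fin k → ℕ} → (∀ i → f i + g i + h i ≤ u i) →
  sum f + sum g + sum h ≤ sum u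
∑-+₃-mono-≤ {f = f} {g} {h} {u} f+g+h≤u = begin
  sum f + sum g + sum h         ≡⟨ cong (_+ sum h) (∑-distrib-+ f g) ⟨
  sum (λ i → f i + g i) + sum h ≡⟨ ∑-distrib-+ (λ i → f i + g i) h ⟨
  sum (λ i → f i + g i + h i)   ≤⟨ ∑-mono-≤ f+g+h≤u ⟩
  sum u                         ∎
  where open ≤-Reasoning

countFin-sum : ∀ {k} (f : Fin k → Bool) → countFin f ≡ ∑[ i < k ] 𝟙 (f i)
countFin-sum {zero}  f = refl
countFin-sum {suc k} f = cong (𝟙 (f zero) +_) (countFin-sum (f ∘ suc))

∣p∣≡countFin : ∀ {k} (p : Subset k) → ∣ p ∣ ≡ countFin (lookup p)
∣p∣≡countFin []          = refl
∣p∣≡countFin (true ∷ p)  = cong suc (∣p∣≡countFin p)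
∣p∣≡countFin (false ∷ p) = ∣p∣≡countFin p

countFin-split : ∀ {k} (s c : Fin k → Bool) → (∀ i → c i ≡ true → s i ≡ true) →
  countFin s ≡ countFin c + countFin (λ i → s i ∧ not (c i))
countFin-split s c c⇒s = begin
  countFin s                                    ≡⟨ countFin-sum s ⟩
  sum (𝟙 ∘ s)                                   ≡⟨ sum-cong-≗ (λ i → 𝟙-split (s i) (c i) (c⇒s i)) ⟩
  sum (λ i → 𝟙 (c i) + 𝟙 (s i ∧ not (c i)))     ≡⟨ ∑-distrib-+ (𝟙 ∘ c) _ ⟩
  sum (𝟙 ∘ c) + sum (λ i → 𝟙 (s i ∧ not (c i))) ≡⟨ cong₂ _+_ (countFin-sum c) (countFin-sum (λ i → s i ∧ not (c i))) ⟨
  countFin c + countFin (λ i → s i ∧ not (c i)) ∎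
  where open ≡-Reasoning

edges : ∀ {m n} → (Fin m → Fin n → Bool) → ℕ
edges {m} {n} R = ∑[ x < m ] ∑[ y < n ] 𝟙 (R x y)

edges-transpose : ∀ {m n} (R : Fin m → Fin n → Bool) → edges R ≡ edges (flip R)
edges-transpose R = ∑-comm (λ x y → 𝟙 (R x y))

edges-∧ˡ : ∀ {m n} (R : Fin m → Fin n → Bool) (P : Fin m → Bool) →
  edges (λ x y → R x y ∧ P x) ≡ ∑[ x < m ] (𝟙 (P x) * countFin (R x))
edges-∧ˡ {m} {n} R P = sum-cong-≗ λ x → begin
  ∑[ y < n ] 𝟙 (R x y ∧ P x)       ≡⟨ sum-cong-≗ (λ y → 𝟙-∧ (R x y) (P x)) ⟩
  ∑[ y < n ] (𝟙 (R x y) * 𝟙 (P x)) ≡⟨ *-distribʳ-sum (𝟙 (P x)) (𝟙 ∘ R x) ⟨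
  (∑[ y < n ] 𝟙 (R x y)) * 𝟙 (P x) ≡⟨ cong (_* 𝟙 (P x)) (countFin-sum (R x)) ⟨
  countFin (R x) * 𝟙 (P x)         ≡⟨ *-comm (countFin (R x)) (𝟙 (P x)) ⟩
  𝟙 (P x) * countFin (R x)         ∎
  where open ≡-Reasoning

edges-regular : ∀ {m n d} (R : Fin m → Fin n → Bool) (P : Fin m → Bool) →
  (∀ x → countFin (R x) ≡ d) → edges (λ x y → R x y ∧ P x) ≡ countFin P * d
edges-regular {m} {n} {d} R P regular = begin
  edges (λ x y → R x y ∧ P x)           ≡⟨ edges-∧ˡ R P ⟩
  ∑[ x < m ] (𝟙 (P x) * countFin (R x)) ≡⟨ sum-cong-≗ (λ x → cong (𝟙 (P x) *_) (regular x)) ⟩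
  ∑[ x < m ] (𝟙 (P x) * d)              ≡⟨ *-distribʳ-sum d (𝟙 ∘ P) ⟨
  (∑[ x < m ] 𝟙 (P x)) * d              ≡⟨ cong (_* d) (countFin-sum P) ⟨
  countFin P * d                        ∎
  where open ≡-Reasoning

edges-≥ : ∀ {m n δ} (R : Fin m → Fin n → Bool) (P : Fin m → Bool) →
  (∀ x → P x ≡ true → δ ≤ countFin (R x)) → countFin P * δ ≤ edges (λ x y → R x y ∧ P x)
edges-≥ {m} {n} {δ} R P degree = begin
  countFin P * δ                        ≡⟨ cong (_* δ) (countFin-sum P) ⟩
  (∑[ x < m ] 𝟙 (P x)) * δ              ≡⟨ *-distribʳ-sum δ (𝟙 ∘ P) ⟩
  ∑[ x < m ] (𝟙 (P x) * δ)              ≤⟨ ∑-mono-≤ (λ x → 𝟙*-mono-≤ (P x) (degree x)) ⟩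
  ∑[ x < m ] (𝟙 (P x) * countFin (R x)) ≡⟨ edges-∧ˡ R P ⟨
  edges (λ x y → R x y ∧ P x)           ∎
  where open ≤-Reasoning

edges-+₃-mono-≤ : ∀ {m n} (R₁ R₂ R₃ R : Fin m → Fin n → Bool) →
  (∀ x y → 𝟙 (R₁ x y) + 𝟙 (R₂ x y) + 𝟙 (R₃ x y) ≤ 𝟙 (R x y)) →
  edges R₁ + edges R₂ + edges R₃ ≤ edges R
edges-+₃-mono-≤ _ _ _ _ pointwise = ∑-+₃-mono-≤ (λ x → ∑-+₃-mono-≤ (pointwise x))

-- For an edge candidate xy: e = adj x y, c = x ∈ [A], s = x ∈ S, f = y ∈ F, g = y ∈ G.
edge-classification : ∀ e c s f g →
  (c ≡ true → s ≡ true) → (f ≡ true → g ≡ true) → (c ≡ true → e ≡ true → g ≡ true) →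
  𝟙 (e ∧ c) + 𝟙 ((e ∧ f) ∧ (s ∧ not c)) + 𝟙 ((e ∧ not s) ∧ (g ∧ not f)) ≤ 𝟙 (e ∧ g)
edge-classification false _ _ _ _ _ _ _ = z≤n
edge-classification true true s f g c⇒s _ c⇒g
  with refl ← c⇒s refl | refl ← c⇒g refl refl rewrite ∧-zeroʳ f = ≤-refl
edge-classification true false true  true  g _ f⇒g _ with refl ← f⇒g refl = ≤-refl
edge-classification true false true  false g _ _   _ = z≤n
edge-classification true false false true  g _ f⇒g _ with refl ← f⇒g refl = z≤n
edge-classification true false false false true  _ _ _ = ≤-refl
edge-classification true false false false false _ _ _ = z≤n

cleared-bound : ∀ a p q f δ ψ → 0 < δ + ψ →
  a * (δ + ψ) + p * δ + q * δ ≤ (f + q) * (δ + ψ) →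
  δ * (a + p) + 2 * ψ * a ≤ δ * f + 2 * ψ * (f + q)
cleared-bound a p q f δ ψ 0<δ+ψ count = begin
  δ * (a + p) + 2 * ψ * a             ≡⟨ split-2ψ (δ * (a + p)) ψ a ⟩
  (δ * (a + p) + ψ * a) + ψ * a       ≤⟨ +-mono-≤ count-without-q (*-monoʳ-≤ ψ a≤f+q) ⟩
  (δ * f + ψ * (f + q)) + ψ * (f + q) ≡⟨ split-2ψ (δ * f) ψ (f + q) ⟨
  δ * f + 2 * ψ * (f + q)             ∎
  where
  open ≤-Reasoning
  split-2ψ : ∀ x ψ y → x + 2 * ψ * y ≡ (x + ψ * y) + ψ * y
  split-2ψ = solve-∀
  expand-lhs : ∀ a δ ψ p q → a * (δ + ψ) + p * δ + q * δ ≡ (δ * (a + p) + ψ * a) + q * δ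
  expand-lhs = solve-∀
  expand-rhs : ∀ f q δ ψ → (f + q) * (δ + ψ) ≡ (δ * f + ψ * (f + q)) + q * δ
  expand-rhs = solve-∀
  a≤f+q : a ≤ f + q
  a≤f+q = *-cancelʳ-≤ a (f + q) (δ + ψ) {{>-nonZero 0<δ+ψ}}
    (≤-trans (≤-trans (m≤m+n _ (p * δ)) (m≤m+n _ (q * δ))) count)
  count-without-q : δ * (a + p) + ψ * a ≤ δ * f + ψ * (f + q)
  count-without-q = +-cancelʳ-≤ (q * δ) _ _
    (subst₂ _≤_ (expand-lhs a δ ψ p q) (expand-rhs f q δ ψ) count)

not-lookup⇒∉ : ∀ {k} {p : Subset k} {i} → not (lookup p i) ≡ true → i ∉ p
not-lookup⇒∉ {p = p} {i} ¬p[i] i∈p with lookup p i | []=⇒lookup i∈p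
not-lookup⇒∉ () i∈p | true | refl

module ApproximationCounting (Γ : BipGraph) (d ψ : ℕ) (regular : Regular Γ d)
  (A : Subset (BipGraph.m Γ)) (F : Subset (BipGraph.n Γ)) (S : Subset (BipGraph.m Γ))
  (approx : IsApprox Γ d ψ A F S) where

  open BipGraph Γ

  [A]? S? : Fin m → Bool
  [A]? = lookup (closure Γ A)
  S?   = lookup S

  F? G? : Fin n → Bool
  F? = lookup F
  G? = lookup (N Γ A)

  S∖[A] : Fin m → Bool
  S∖[A] x = S? x ∧ not ([A]? x)

  G∖F : Fin n → Bool
  G∖F y = G? y ∧ not (F? y)

  δ : ℕ
  δ = d ∸ ψ

  [A]⊆S : ∀ x → [A]? x ≡ true → S? x ≡ true
  [A]⊆S x x∈[A] = let (_ , closure⊆S , _) = approx in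
    []=⇒lookup (closure⊆S (lookup⇒[]= x (closure Γ A) x∈[A]))

  F⊆G : ∀ y → F? y ≡ true → G? y ≡ true
  F⊆G y y∈F = let (F⊆N , _) = approx in []=⇒lookup (F⊆N (lookup⇒[]= y F y∈F))

  closure-adj : ∀ x y → [A]? x ≡ true → adj x y ≡ true → G? y ≡ true
  closure-adj x y x∈[A] xy = subst (λ b → not b ∨ G? y ≡ true) xy
    (allFin-true _ (trans (sym (lookup∘tabulate _ x)) x∈[A]) y)

  ∣S∣-split : ∣ S ∣ ≡ ∣ closure Γ A ∣ + countFin S∖[A]
  ∣S∣-split = begin
    ∣ S ∣                            ≡⟨ ∣p∣≡countFin S ⟩
    countFin S?                      ≡⟨ countFin-split S? [A]? [A]⊆S ⟩
    countFin [A]? + countFin S∖[A]   ≡⟨ cong (_+ countFin S∖[A]) (∣p∣≡countFin (closure Γ A)) ⟨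
    ∣ closure Γ A ∣ + countFin S∖[A] ∎
    where open ≡-Reasoning

  ∣G∣-split : ∣ N Γ A ∣ ≡ ∣ F ∣ + countFin G∖F
  ∣G∣-split = begin
    ∣ N Γ A ∣                  ≡⟨ ∣p∣≡countFin (N Γ A) ⟩
    countFin G?                ≡⟨ countFin-split G? F? F⊆G ⟩
    countFin F? + countFin G∖F ≡⟨ cong (_+ countFin G∖F) (∣p∣≡countFin F) ⟨
    ∣ F ∣ + countFin G∖F       ∎
    where open ≡-Reasoning

  edge-count : ∣ closure Γ A ∣ * d + countFin S∖[A] * δ + countFin G∖F * δ ≤ ∣ N Γ A ∣ * d
  edge-count = begin
    ∣ closure Γ A ∣ * d + countFin S∖[A] * δ + countFin G∖F * δ
      ≤⟨ +-mono-≤ (+-mono-≤ (≤-reflexive from-[A]) from-S∖[A]) from-G∖F ⟩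
    edges R₁ + edges R₂ + edges R₃
      ≤⟨ edges-+₃-mono-≤ R₁ R₂ R₃ into-G classify ⟩
    edges into-G
      ≡⟨ edges-transpose into-G ⟩
    edges (λ y x → adj x y ∧ G? y)
      ≡⟨ edges-regular (λ y x → adj x y) G? (proj₂ regular) ⟩
    countFin G? * d
      ≡⟨ cong (_* d) (∣p∣≡countFin (N Γ A)) ⟨
    ∣ N Γ A ∣ * d ∎
    where
    open ≤-Reasoning
    R₁ R₂ R₃ into-G : Fin m → Fin n → Bool
    R₁ x y = adj x y ∧ [A]? x
    R₂ x y = (adj x y ∧ F? y) ∧ S∖[A] x
    R₃ x y = (adj x y ∧ lookup (∁ S) x) ∧ G∖F y
    into-G x y = adj x y ∧ G? y

    from-[A] : ∣ closure Γ A ∣ * d ≡ edges R₁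
    from-[A] = trans (cong (_* d) (∣p∣≡countFin (closure Γ A)))
      (sym (edges-regular adj [A]? (proj₁ regular)))

    from-S∖[A] : countFin S∖[A] * δ ≤ edges R₂
    from-S∖[A] = let (_ , _ , degree-S , _) = approx in
      edges-≥ (λ x y → adj x y ∧ F? y) S∖[A] λ x x∈S∖[A] →
        degree-S x (lookup⇒[]= x S (∧-conicalˡ _ _ x∈S∖[A]))

    from-G∖F : countFin G∖F * δ ≤ edges R₃
    from-G∖F = let (_ , _ , _ , degree-∁F) = approx in
      subst (countFin G∖F * δ ≤_) (sym (edges-transpose R₃))
        (edges-≥ (λ y x → adj x y ∧ lookup (∁ S) x) G∖F λ y y∈G∖F →
          degree-∁F y (not-lookup⇒∉ (∧-conicalʳ _ _ y∈G∖F)))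

    classify : ∀ x y → 𝟙 (R₁ x y) + 𝟙 (R₂ x y) + 𝟙 (R₃ x y) ≤ 𝟙 (into-G x y)
    classify x y rewrite lookup-map x not S =
      edge-classification (adj x y) ([A]? x) (S? x) (F? y) (G? y)
        ([A]⊆S x) (F⊆G y) (closure-adj x y)

lemma5p3 : (Γ : BipGraph) (d ψ : ℕ) → Regular Γ d → 1 ≤ ψ → ψ + 1 ≤ d →
    (a g : ℕ) (v : Fin (BipGraph.n Γ)) (A : Subset (BipGraph.m Γ)) →
    InG Γ a g v A →
    (F : Subset (BipGraph.n Γ)) (S : Subset (BipGraph.m Γ)) →
    IsApprox Γ d ψ A F S →
    (d ∸ ψ) * ∣ S ∣ + 2 * ψ * a ≤ (d ∸ ψ) * ∣ F ∣ + 2 * ψ * g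
lemma5p3 Γ d ψ regular _ ψ+1≤d _ _ _ A (_ , refl , refl , _) F S approx = begin
  δ * ∣ S ∣ + 2 * ψ * ∣ [A] ∣
    ≡⟨ cong (λ s → δ * s + 2 * ψ * ∣ [A] ∣) ∣S∣-split ⟩
  δ * (∣ [A] ∣ + countFin S∖[A]) + 2 * ψ * ∣ [A] ∣
    ≤⟨ cleared-bound (∣ [A] ∣) (countFin S∖[A]) (countFin G∖F) (∣ F ∣) δ ψ 0<δ+ψ count ⟩
  δ * ∣ F ∣ + 2 * ψ * (∣ F ∣ + countFin G∖F)
    ≡⟨ cong (λ g → δ * ∣ F ∣ + 2 * ψ * g) ∣G∣-split ⟨
  δ * ∣ F ∣ + 2 * ψ * ∣ N Γ A ∣ ∎
  where
  open ≤-Reasoning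
  open ApproximationCounting Γ d ψ regular A F S approx
  [A] : Subset (BipGraph.m Γ)
  [A] = closure Γ A
  d≡δ+ψ : d ≡ δ + ψ
  d≡δ+ψ = sym (m∸n+n≡m (≤-trans (m≤m+n ψ 1) ψ+1≤d))
  0<δ+ψ : 0 < δ + ψ
  0<δ+ψ = ≤-trans (m≤n+m 1 ψ) (≤-trans ψ+1≤d (≤-reflexive d≡δ+ψ))
  count : ∣ [A] ∣ * (δ + ψ) + countFin S∖[A] * δ + countFin G∖F * δ ≤ (∣ F ∣ + countFin G∖F) * (δ + ψ)
  count = begin
    ∣ [A] ∣ * (δ + ψ) + countFin S∖[A] * δ + countFin G∖F * δ
      ≡⟨ cong (λ e → ∣ [A] ∣ * e + countFin S∖[A] * δ + countFin G∖F * δ) d≡δ+ψ ⟨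
    ∣ [A] ∣ * d + countFin S∖[A] * δ + countFin G∖F * δ
      ≤⟨ edge-count ⟩
    ∣ N Γ A ∣ * d
      ≡⟨ cong₂ _*_ ∣G∣-split d≡δ+ψ ⟩
    (∣ F ∣ + countFin G∖F) * (δ + ψ) ∎
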